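{- Let $m\ge 1$ and let $A$ be a $2m\times 2m$ centrosymmetric $(0,1)$-matrix. Then there exists a centrosymmetric permutation matrix $P$ with $P\le A$ (entrywise) if and only if there does not exist a centrosymmetric cover of $A$ of size $<2m$. More generally, $\rho_{\pi}(A)=\beta_{\pi}(A)$.
   Context: For an $n\times n$ matrix $A=[a_{ij}]$, $A^{\pi}$ denotes the matrix obtained by rotating $A$ by 180 degrees, i.e. the $(i,j)$ entry of $A^{\pi}$ is $a_{n+1-i,n+1-j}$; $A$ is centrosymmetric if $A^{\pi}=A$. A set of $1$'s (i.e. of positions $(i,j)$ with $a_{ij}=1$) of a $(0,1)$-matrix $A$ is $\pi$-invariant if it is invariant under the map $(i,j)\mapsto(n+1-i,n+1-j)$. The centrosymmetric term rank $\rho_{\pi}(A)$ is the maximum cardinality of a $\pi$-invariant set of $1$'s of $A$ with no two of the $1$'s in the same row or the same column. A set of rows and columns of $A$ is $\pi$-invariant if it is invariant under the rotation sending row $i$ to row $n+1-i$ and column $j$ to column $n+1-j$. A centrosymmetric cover of $A$ is a $\pi$-invariant set of rows and columns of $A$ that together contain all the $1$'s of $A$; $\beta_{\pi}(A)$ denotes the minimum cardinality of a centrosymmetric cover of $A$. -}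

module Defs where

open import Data.Nat using (ℕ; zero; suc; _+_)
open import Data.Bool using (Bool; true; false; if_then_else_)
open import Data.Fin using (Fin; zero; suc; opposite)
open import Data.Fin.Subset using (Subset; _∈_; ∣_∣)
open import Data.Product using (Σ; _×_; _,_)
open import Data.Sum using (_⊎_)
open import Relation.Binary.PropositionalEquality using (_≡_)

Matrix01 : ℕ → Set
Matrix01 n = Fin n → Fin n → Bool

-- The rotation i ↦ n+1-i (1-based), i.e. i ↦ n-1-i on Fin n.
rot : ∀ {n} → Fin n → Fin n
rot = opposite

Centrosymmetric : ∀ {n} → Matrix01 n → Set
Centrosymmetric {n} A = ∀ (i j : Fin n) → A (rot i) (rot j) ≡ A i j

_≤ₘ_ : ∀ {n} → Matrix01 n → Matrix01 n → Set
_≤ₘ_ {n} P A = ∀ (i j : Fin n) → P i j ≡ true → A i j ≡ true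

IsPermutationMatrix : ∀ {n} → Matrix01 n → Set
IsPermutationMatrix {n} P =
  (∀ (i : Fin n) → Σ (Fin n) λ j → (P i j ≡ true) × (∀ j' → P i j' ≡ true → j' ≡ j)) ×
  (∀ (j : Fin n) → Σ (Fin n) λ i → (P i j ≡ true) × (∀ i' → P i' j ≡ true → i' ≡ i))

sumFin : ∀ {n} → (Fin n → ℕ) → ℕ
sumFin {zero} f = 0
sumFin {suc n} f = f zero + sumFin (λ i → f (suc i))

PosSet : ℕ → Set
PosSet n = Fin n → Fin n → Bool

card : ∀ {n} → PosSet n → ℕ
card S = sumFin (λ i → sumFin (λ j → if S i j then 1 else 0))

IsPiIndepSet : ∀ {n} → Matrix01 n → PosSet n → Set
IsPiIndepSet {n} A S =
  (∀ (i j : Fin n) → S i j ≡ true → A i j ≡ true) ×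
  (∀ (i j : Fin n) → S i j ≡ true → S (rot i) (rot j) ≡ true) ×
  (∀ (i j j' : Fin n) → S i j ≡ true → S i j' ≡ true → j ≡ j') ×
  (∀ (i i' j : Fin n) → S i j ≡ true → S i' j ≡ true → i ≡ i')

IsCentroCover : ∀ {n} → Matrix01 n → Subset n → Subset n → Set
IsCentroCover {n} A R C =
  (∀ (i : Fin n) → i ∈ R → rot i ∈ R) ×
  (∀ (j : Fin n) → j ∈ C → rot j ∈ C) ×
  (∀ (i j : Fin n) → A i j ≡ true → (i ∈ R) ⊎ (j ∈ C))

coverSize : ∀ {n} → Subset n → Subset n → ℕ
coverSize R C = ∣ R ∣ + ∣ C ∣

open import Data.Nat using (_≤_)

IsRhoPi : ∀ {n} → Matrix01 n → ℕ → Set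
IsRhoPi {n} A k =
  (Σ (PosSet n) λ S → IsPiIndepSet A S × (card S ≡ k)) ×
  (∀ (S : PosSet n) → IsPiIndepSet A S → card S ≤ k)

IsBetaPi : ∀ {n} → Matrix01 n → ℕ → Set
IsBetaPi {n} A k =
  (Σ (Subset n) λ R → Σ (Subset n) λ C → IsCentroCover A R C × (coverSize R C ≡ k)) ×
  (∀ (R C : Subset n) → IsCentroCover A R C → k ≤ coverSize R C)

-- Every π-orbit {x, rot x} of rows of a 2m × 2m matrix contains exactly one row top p of the
-- upper half, and likewise for columns, so an orbit {(x, y), (rot x, rot y)} of positions is
-- represented by (top p, top q) or by (top p, bot q), where bot q = rot (top q).  Folding a
-- centrosymmetric A along these orbits gives the m × m matrix E p q = A (top p) (top q) ∨
-- A (top p) (bot q).  A matching of E spreads to a π-invariant independent set of 1's of A of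
-- twice its size, and a cover of E lifts to a centrosymmetric cover of A of twice its size, so
-- König's theorem for E yields an independent set and a cover of equal size.  As no independent
-- set is larger than a cover, both are optimal and ρπ = βπ; a centrosymmetric permutation
-- matrix below A is exactly an independent set of size 2m.
--
-- König's theorem is proved for the subgraph induced by row and column sets Rs, Cs, by induction
-- on ∣ Rs ∣ + ∣ Cs ∣: if a minimum cover (R, C) has both a row and a column, the subproblems
-- (R, Cs ─ C) and (Rs ─ R, C) have matchings of sizes ∣ R ∣ and ∣ C ∣ by minimality, and their
-- union is a matching of size ∣ R ∣ + ∣ C ∣.  Otherwise delete the two ends of an edge (i, j):
-- either the matching for the rest plus (i, j) reaches the minimum, or the cover for the rest
-- plus i and j is a minimum cover with both a row and a column.

module Submission where

open import Defs
open import Data.Nat using (ℕ; _+_; _≤_; _<_)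
open import Data.Fin.Subset using (Subset)
open import Data.Product using (Σ; _×_; ∃)
open import Relation.Nullary using (¬_)
open import Function.Bundles using (_⇔_)

open import Data.Bool using (Bool; true; false; not; _∧_; _∨_; _xor_; if_then_else_)
import Data.Bool.Properties as Boolₚ
open import Data.Empty using (⊥; ⊥-elim)
open import Data.Fin using (Fin; zero; suc; opposite; toℕ; _↑ˡ_; _↑ʳ_; inject₁; fromℕ; splitAt; join; _≟_)
import Data.Fin.Properties as Finₚ
import Data.Fin.Subset as Sub
open Sub using (_∈_; _∉_; _⊆_; ∣_∣; _∪_; _─_; _-_; ⁅_⁆; inside; outside)
open import Data.Fin.Subset.Properties
  using (_∈?_; _⊆?_; ∈⊤; ∉⊥; ∣⊥∣≡0; ∣⁅x⁆∣≡1; ∣p∣≤∣x∷p∣; p⊆q⇒∣p∣≤∣q∣; p⊆p∪q; q⊆p∪q; x∈p∪q⁻;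
         x∈p∩q⁺; x∈⁅x⁆; x∈⁅y⁆⇒x≡y; p─q⊆p; x∈p∧x∉q⇒x∈p─q; ∣p─q∣≤∣p∣; p∩q≢∅⇒∣p─q∣<∣p∣;
         x∈p⇒∣p-x∣<∣p∣; anySubset?)
open import Data.Nat using (zero; suc; _∸_; z≤n; s≤s)
open import Data.Nat.Induction using (<-rec)
open import Data.Nat.Properties
  using (≤-trans; ≤-reflexive; ≤-antisym; _≤?_; ≰⇒>; <⇒≱; ≮⇒≥; anyUpTo?;
         +-assoc; +-comm; +-suc; +-∸-assoc; +-mono-≤; +-monoˡ-≤; +-monoʳ-≤; +-mono-<-≤; +-mono-≤-<;
         +-cancelˡ-≤; +-cancelʳ-≤; m≤m+n; m≤n+m; +-commutativeSemigroup; module ≤-Reasoning)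
import Data.Nat.Properties as Natₚ
open import Algebra.Properties.CommutativeSemigroup +-commutativeSemigroup using (interchange; x∙yz≈xz∙y)
open import Data.Product using (_,_; proj₁; proj₂)
open import Data.Sum using (_⊎_; inj₁; inj₂; [_,_]′; map₁; map₂) renaming (map to map-⊎)
open import Data.Vec using ([]; _∷_; lookup; tabulate; here; there)
open import Data.Vec.Properties using ([]=⇒lookup; lookup⇒[]=; lookup∘tabulate)
open import Function using (_∘_; flip; id; const)
open import Function.Bundles using (mk⇔)
open import Relation.Binary.PropositionalEquality
open import Relation.Nullary using (Dec; yes; no; does; contradiction)
open import Relation.Nullary.Decidable using (_×-dec_; _⊎-dec_; _→-dec_)
open import Relation.Unary as U using ()

indicator : Bool → ℕ
indicator b = if b then 1 else 0

sumFin-cong : ∀ {n} {f g : Fin n → ℕ} → (∀ i → f i ≡ g i) → sumFin f ≡ sumFin g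
sumFin-cong {zero}  f≗g = refl
sumFin-cong {suc n} f≗g = cong₂ _+_ (f≗g zero) (sumFin-cong (f≗g ∘ suc))

sumFin-+ : ∀ {n} (f g : Fin n → ℕ) → sumFin (λ i → f i + g i) ≡ sumFin f + sumFin g
sumFin-+ {zero}  f g = refl
sumFin-+ {suc n} f g = begin
  f zero + g zero + sumFin (λ i → f (suc i) + g (suc i))
    ≡⟨ cong (f zero + g zero +_) (sumFin-+ (f ∘ suc) (g ∘ suc)) ⟩
  f zero + g zero + (sumFin (f ∘ suc) + sumFin (g ∘ suc))
    ≡⟨ interchange (f zero) (g zero) _ _ ⟩
  f zero + sumFin (f ∘ suc) + (g zero + sumFin (g ∘ suc)) ∎
  where open ≡-Reasoning

sumFin-zero : ∀ n → sumFin {n} (λ _ → 0) ≡ 0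
sumFin-zero zero    = refl
sumFin-zero (suc n) = sumFin-zero n

sumFin-one : ∀ n → sumFin {n} (λ _ → 1) ≡ n
sumFin-one zero    = refl
sumFin-one (suc n) = cong suc (sumFin-one n)

sumFin-mono-≤ : ∀ {n} {f g : Fin n → ℕ} → (∀ i → f i ≤ g i) → sumFin f ≤ sumFin g
sumFin-mono-≤ {zero}  f≤g = z≤n
sumFin-mono-≤ {suc n} f≤g = +-mono-≤ (f≤g zero) (sumFin-mono-≤ (f≤g ∘ suc))

sumFin-mono-< : ∀ {n} {f g : Fin n → ℕ} → (∀ i → f i ≤ g i) → ∀ k → f k < g k → sumFin f < sumFin g
sumFin-mono-< f≤g zero    fk<gk = +-mono-<-≤ fk<gk (sumFin-mono-≤ (f≤g ∘ suc))
sumFin-mono-< f≤g (suc k) fk<gk = +-mono-≤-< (f≤g zero) (sumFin-mono-< (f≤g ∘ suc) k fk<gk)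

term≤sumFin : ∀ {n} (f : Fin n → ℕ) k → f k ≤ sumFin f
term≤sumFin f zero    = m≤m+n _ _
term≤sumFin f (suc k) = ≤-trans (term≤sumFin (f ∘ suc) k) (m≤n+m _ _)

sumFin-comm : ∀ {a b} (h : Fin a → Fin b → ℕ) →
  sumFin (λ i → sumFin (h i)) ≡ sumFin (λ j → sumFin (λ i → h i j))
sumFin-comm {zero}  {b} h = sym (sumFin-zero b)
sumFin-comm {suc a} h = begin
  sumFin (h zero) + sumFin (λ i → sumFin (h (suc i)))
    ≡⟨ cong (sumFin (h zero) +_) (sumFin-comm (h ∘ suc)) ⟩
  sumFin (h zero) + sumFin (λ j → sumFin (λ i → h (suc i) j))
    ≡⟨ sumFin-+ (h zero) _ ⟨
  sumFin (λ j → sumFin (λ i → h i j)) ∎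
  where open ≡-Reasoning

sumFin-↑ : ∀ a {b} (f : Fin (a + b) → ℕ) → sumFin f ≡ sumFin (λ i → f (i ↑ˡ b)) + sumFin (λ j → f (a ↑ʳ j))
sumFin-↑ zero    f = refl
sumFin-↑ (suc a) f = trans (cong (f zero +_) (sumFin-↑ a (f ∘ suc))) (sym (+-assoc (f zero) _ _))

sumFin-inject₁ : ∀ n (f : Fin (suc n) → ℕ) → sumFin f ≡ sumFin (f ∘ inject₁) + f (fromℕ n)
sumFin-inject₁ zero    f = +-comm (f zero) 0
sumFin-inject₁ (suc n) f = trans (cong (f zero +_) (sumFin-inject₁ n (f ∘ suc))) (sym (+-assoc (f zero) _ _))

sumFin-opposite : ∀ n (f : Fin n → ℕ) → sumFin (f ∘ opposite) ≡ sumFin f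
sumFin-opposite zero    f = refl
sumFin-opposite (suc n) f = begin
  f (fromℕ n) + sumFin (λ i → f (opposite (suc i)))
    ≡⟨ cong (f (fromℕ n) +_) (sumFin-opposite n (f ∘ inject₁)) ⟩
  f (fromℕ n) + sumFin (f ∘ inject₁)   ≡⟨ +-comm (f (fromℕ n)) _ ⟩
  sumFin (f ∘ inject₁) + f (fromℕ n)   ≡⟨ sumFin-inject₁ n f ⟨
  sumFin f ∎
  where open ≡-Reasoning

true⇒1≤sumFin : ∀ {n} (f : Fin n → Bool) k → f k ≡ true → 1 ≤ sumFin (indicator ∘ f)
true⇒1≤sumFin f k fk = ≤-trans (≤-reflexive (cong indicator (sym fk))) (term≤sumFin (indicator ∘ f) k)

sumFin-indicator-≤1 : ∀ {n} (f : Fin n → Bool) → (∀ j j' → f j ≡ true → f j' ≡ true → j ≡ j') →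
  sumFin (indicator ∘ f) ≤ 1
sumFin-indicator-≤1 {zero}  f unique = z≤n
sumFin-indicator-≤1 {suc n} f unique with f zero in f0
... | false = sumFin-indicator-≤1 (f ∘ suc) (λ j j' p q → Finₚ.suc-injective (unique (suc j) (suc j') p q))
... | true  = s≤s (≤-reflexive (trans (sumFin-cong rest-false) (sumFin-zero n)))
  where
  rest-false : ∀ j → indicator (f (suc j)) ≡ 0
  rest-false j with f (suc j) in fj
  ... | false = refl
  ... | true  with () ← unique zero (suc j) f0 fj

sumFin-indicator-witness : ∀ {n} (f : Fin n → Bool) → 0 < sumFin (indicator ∘ f) → ∃ λ j → f j ≡ true
sumFin-indicator-witness {suc n} f pos with f zero in f0
... | true  = zero , f0
... | false = let j , fj = sumFin-indicator-witness (f ∘ suc) pos in suc j , fj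

∣p∣≡sumFin : ∀ {n} (p : Subset n) → ∣ p ∣ ≡ sumFin (indicator ∘ lookup p)
∣p∣≡sumFin []            = refl
∣p∣≡sumFin (true  ∷ p) = cong suc (∣p∣≡sumFin p)
∣p∣≡sumFin (false ∷ p) = ∣p∣≡sumFin p

∣p∪q∣≤∣p∣+∣q∣ : ∀ {n} (p q : Subset n) → ∣ p ∪ q ∣ ≤ ∣ p ∣ + ∣ q ∣
∣p∪q∣≤∣p∣+∣q∣ []          []          = z≤n
∣p∪q∣≤∣p∣+∣q∣ (true  ∷ p) (y     ∷ q) =
  s≤s (≤-trans (∣p∪q∣≤∣p∣+∣q∣ p q) (+-monoʳ-≤ ∣ p ∣ (∣p∣≤∣x∷p∣ y q)))
∣p∪q∣≤∣p∣+∣q∣ (false ∷ p) (true  ∷ q) =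
  ≤-trans (s≤s (∣p∪q∣≤∣p∣+∣q∣ p q)) (≤-reflexive (sym (+-suc ∣ p ∣ ∣ q ∣)))
∣p∪q∣≤∣p∣+∣q∣ (false ∷ p) (false ∷ q) = ∣p∪q∣≤∣p∣+∣q∣ p q

x∈p─q⇒x∉q : ∀ {n} {x : Fin n} (p q : Subset n) → x ∈ p ─ q → x ∉ q
x∈p─q⇒x∉q {x = zero}  (inside  ∷ _) (outside ∷ _) here ()
x∈p─q⇒x∉q {x = zero}  (outside ∷ _) (outside ∷ _) ()
x∈p─q⇒x∉q {x = zero}  (_       ∷ _) (inside  ∷ _) ()
x∈p─q⇒x∉q {x = suc x} (_       ∷ p) (_       ∷ q) (there x∈p─q) (there x∈q) = x∈p─q⇒x∉q p q x∈p─q x∈q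

∨-true : ∀ x y → x ∨ y ≡ true → x ≡ true ⊎ y ≡ true
∨-true true  y _  = inj₁ refl
∨-true false y eq = inj₂ eq

BoolRel : ℕ → ℕ → Set
BoolRel a b = Fin a → Fin b → Bool

count : ∀ {a b} → BoolRel a b → ℕ
count M = sumFin (λ i → sumFin (λ j → indicator (M i j)))

AtMostOnePerRow : ∀ {a b} → BoolRel a b → Set
AtMostOnePerRow M = ∀ i j j' → M i j ≡ true → M i j' ≡ true → j ≡ j'

AtMostOnePerColumn : ∀ {a b} → BoolRel a b → Set
AtMostOnePerColumn M = ∀ i i' j → M i j ≡ true → M i' j ≡ true → i ≡ i'

_∪ᵣ_ : ∀ {a b} → BoolRel a b → BoolRel a b → BoolRel a b
(M ∪ᵣ N) i j = M i j ∨ N i j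

count-empty : ∀ a b → count {a} {b} (λ _ _ → false) ≡ 0
count-empty a b = trans (sumFin-cong {a} (λ _ → sumFin-zero b)) (sumFin-zero a)

count-flip : ∀ {a b} → (M : BoolRel a b) → count (flip M) ≡ count M
count-flip M = sym (sumFin-comm (λ i j → indicator (M i j)))

count-∪ᵣ : ∀ {a b} → (M N : BoolRel a b) → (∀ i j → M i j ≡ true → N i j ≡ true → ⊥) →
  count (M ∪ᵣ N) ≡ count M + count N
count-∪ᵣ M N disjoint = begin
  count (M ∪ᵣ N)
    ≡⟨ sumFin-cong (λ i → sumFin-cong (λ j → indicator-∨ (M i j) (N i j) (disjoint i j))) ⟩
  sumFin (λ i → sumFin (λ j → indicator (M i j) + indicator (N i j)))
    ≡⟨ sumFin-cong (λ i → sumFin-+ (λ j → indicator (M i j)) (λ j → indicator (N i j))) ⟩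
  sumFin (λ i → sumFin (λ j → indicator (M i j)) + sumFin (λ j → indicator (N i j)))
    ≡⟨ sumFin-+ (λ i → sumFin (λ j → indicator (M i j))) (λ i → sumFin (λ j → indicator (N i j))) ⟩
  count M + count N ∎
  where
  open ≡-Reasoning
  indicator-∨ : ∀ x y → (x ≡ true → y ≡ true → ⊥) → indicator (x ∨ y) ≡ indicator x + indicator y
  indicator-∨ true  true  both = ⊥-elim (both refl refl)
  indicator-∨ true  false _    = refl
  indicator-∨ false y     _    = refl

entry⇒1≤count : ∀ {a b} → (M : BoolRel a b) → ∀ i j → M i j ≡ true → 1 ≤ count M
entry⇒1≤count M i j Mij =
  ≤-trans (true⇒1≤sumFin (M i) j Mij) (term≤sumFin (λ i → sumFin (λ j → indicator (M i j))) i)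

count-restrictRows-≤ : ∀ {a b} → (R : Subset a) (M : BoolRel a b) → AtMostOnePerRow M →
  count (λ i j → lookup R i ∧ M i j) ≤ ∣ R ∣
count-restrictRows-≤ {b = b} R M one = ≤-trans (sumFin-mono-≤ row≤) (≤-reflexive (sym (∣p∣≡sumFin R)))
  where
  row≤ : ∀ i → sumFin (λ j → indicator (lookup R i ∧ M i j)) ≤ indicator (lookup R i)
  row≤ i with lookup R i
  ... | true  = sumFin-indicator-≤1 (M i) (one i)
  ... | false = ≤-reflexive (sumFin-zero b)

count-≤-cover : ∀ {a b} → (M : BoolRel a b) → AtMostOnePerRow M → AtMostOnePerColumn M →
  (R : Subset a) (C : Subset b) → (∀ i j → M i j ≡ true → i ∈ R ⊎ j ∈ C) →
  count M ≤ ∣ R ∣ + ∣ C ∣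
count-≤-cover M oneRow oneCol R C covered = begin
  count M
    ≤⟨ sumFin-mono-≤ (λ i → sumFin-mono-≤ (λ j → split i j)) ⟩
  sumFin (λ i → sumFin (λ j → indicator (lookup R i ∧ M i j) + indicator (lookup C j ∧ M i j)))
    ≡⟨ sumFin-cong (λ i → sumFin-+ (λ j → indicator (lookup R i ∧ M i j)) _) ⟩
  sumFin (λ i → sumFin (λ j → indicator (lookup R i ∧ M i j)) + sumFin (λ j → indicator (lookup C j ∧ M i j)))
    ≡⟨ sumFin-+ (λ i → sumFin (λ j → indicator (lookup R i ∧ M i j)))
               (λ i → sumFin (λ j → indicator (lookup C j ∧ M i j))) ⟩
  count (λ i j → lookup R i ∧ M i j) + count (λ i j → lookup C j ∧ M i j)
    ≡⟨ cong (count (λ i j → lookup R i ∧ M i j) +_) (count-flip (λ i j → lookup C j ∧ M i j)) ⟨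
  count (λ i j → lookup R i ∧ M i j) + count (λ j i → lookup C j ∧ M i j)
    ≤⟨ +-mono-≤ (count-restrictRows-≤ R M oneRow)
                (count-restrictRows-≤ C (flip M) (λ j i i' → oneCol i i' j)) ⟩
  ∣ R ∣ + ∣ C ∣ ∎
  where
  open ≤-Reasoning
  split : ∀ i j → indicator (M i j) ≤ indicator (lookup R i ∧ M i j) + indicator (lookup C j ∧ M i j)
  split i j with M i j in Mij
  ... | false = z≤n
  ... | true  with covered i j Mij
  ...   | inj₁ i∈R rewrite []=⇒lookup i∈R = s≤s z≤n
  ...   | inj₂ j∈C rewrite []=⇒lookup j∈C = m≤n+m 1 _

rows-occupied⇒≤count : ∀ {a b} → (M : BoolRel a b) → (∀ i → ∃ λ j → M i j ≡ true) → a ≤ count M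
rows-occupied⇒≤count {a} M occupied = begin
  a                      ≡⟨ sumFin-one a ⟨
  sumFin {a} (λ _ → 1)
    ≤⟨ sumFin-mono-≤ (λ i → true⇒1≤sumFin (M i) (proj₁ (occupied i)) (proj₂ (occupied i))) ⟩
  count M ∎
  where open ≤-Reasoning

≤count⇒rows-occupied : ∀ {a b} → (M : BoolRel a b) → AtMostOnePerRow M → a ≤ count M →
  ∀ i → ∃ λ j → M i j ≡ true
≤count⇒rows-occupied {a} M one a≤count i =
  sumFin-indicator-witness (M i) (≰⇒> λ row≤0 → <⇒≱ (count<a row≤0) a≤count)
  where
  count<a : sumFin (indicator ∘ M i) ≤ 0 → count M < a
  count<a row≤0 = ≤-trans
    (sumFin-mono-< (λ k → sumFin-indicator-≤1 (M k) (one k)) i (s≤s row≤0))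
    (≤-reflexive (sumFin-one a))

AtMostOnePerRow-∪ᵣ : ∀ {a b} {M N : BoolRel a b} → AtMostOnePerRow M → AtMostOnePerRow N →
  (∀ i j j' → M i j ≡ true → N i j' ≡ true → ⊥) → AtMostOnePerRow (M ∪ᵣ N)
AtMostOnePerRow-∪ᵣ {M = M} {N} oneM oneN apart i j j' Mij Mij'
  with ∨-true (M i j) (N i j) Mij | ∨-true (M i j') (N i j') Mij'
... | inj₁ p | inj₁ q = oneM i j j' p q
... | inj₂ p | inj₂ q = oneN i j j' p q
... | inj₁ p | inj₂ q = ⊥-elim (apart i j j' p q)
... | inj₂ p | inj₁ q = ⊥-elim (apart i j' j q p)

AtMostOnePerColumn-∪ᵣ : ∀ {a b} {M N : BoolRel a b} → AtMostOnePerColumn M → AtMostOnePerColumn N →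
  (∀ i i' j → M i j ≡ true → N i' j ≡ true → ⊥) → AtMostOnePerColumn (M ∪ᵣ N)
AtMostOnePerColumn-∪ᵣ {M = M} {N} oneM oneN apart i i' j Mij Mi'j
  with ∨-true (M i j) (N i j) Mij | ∨-true (M i' j) (N i' j) Mi'j
... | inj₁ p | inj₁ q = oneM i i' j p q
... | inj₂ p | inj₂ q = oneN i i' j p q
... | inj₁ p | inj₂ q = ⊥-elim (apart i i' j p q)
... | inj₂ p | inj₁ q = ⊥-elim (apart i' i j q p)

single : ∀ {a b} → Fin a → Fin b → BoolRel a b
single i j x y = does (x ≟ i) ∧ does (y ≟ j)

single-true : ∀ {a b} (i : Fin a) (j : Fin b) x y → single i j x y ≡ true → x ≡ i × y ≡ j
single-true i j x y eq with x ≟ i | y ≟ j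
... | yes x≡i | yes y≡j = x≡i , y≡j

single-self : ∀ {a b} (i : Fin a) (j : Fin b) → single i j i j ≡ true
single-self i j with i ≟ i | j ≟ j
... | yes _ | yes _ = refl
... | no i≢i | _ = contradiction refl i≢i
... | yes _ | no j≢j = contradiction refl j≢j

least-witness : ∀ {p} {P : ℕ → Set p} → U.Decidable P → ∀ {n} → P n →
  ∃ λ k → P k × (∀ {j} → P j → k ≤ j)
least-witness {P = P} P? {n} = <-rec (λ n → P n → ∃ λ k → P k × (∀ {j} → P j → k ≤ j)) search n
  where
  search : ∀ n → (∀ {j} → j < n → P j → ∃ λ k → P k × (∀ {j} → P j → k ≤ j)) →
    P n → ∃ λ k → P k × (∀ {j} → P j → k ≤ j)
  search n below Pn with anyUpTo? P? n
  ... | yes (j , j<n , Pj) = below j<n Pj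
  ... | no none            = n , Pn , λ {j} Pj → ≮⇒≥ (λ j<n → none (j , j<n , Pj))

module König {a b : ℕ} (E : BoolRel a b) where

  record IsMatching (Rs : Subset a) (Cs : Subset b) (M : BoolRel a b) : Set where
    field
      edge      : ∀ i j → M i j ≡ true → E i j ≡ true × i ∈ Rs × j ∈ Cs
      oneRow    : AtMostOnePerRow M
      oneColumn : AtMostOnePerColumn M

    row∈ : ∀ {i j} → M i j ≡ true → i ∈ Rs
    row∈ {i} {j} Mij = proj₁ (proj₂ (edge i j Mij))

    column∈ : ∀ {i j} → M i j ≡ true → j ∈ Cs
    column∈ {i} {j} Mij = proj₂ (proj₂ (edge i j Mij))

  IsCover : Subset a → Subset b → Subset a → Subset b → Set
  IsCover Rs Cs R C = R ⊆ Rs × C ⊆ Cs × (∀ i j → E i j ≡ true → i ∈ Rs → j ∈ Cs → i ∈ R ⊎ j ∈ C)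

  record KönigPair (Rs : Subset a) (Cs : Subset b) : Set where
    field
      matching   : BoolRel a b
      rows       : Subset a
      cols       : Subset b
      isMatching : IsMatching Rs Cs matching
      isCover    : IsCover Rs Cs rows cols
      count≡     : count matching ≡ ∣ rows ∣ + ∣ cols ∣

  record MinimumCover (Rs : Subset a) (Cs : Subset b) : Set where
    field
      rows    : Subset a
      cols    : Subset b
      isCover : IsCover Rs Cs rows cols
      minimum : ∀ R C → IsCover Rs Cs R C → ∣ rows ∣ + ∣ cols ∣ ≤ ∣ R ∣ + ∣ C ∣

  isCover? : ∀ Rs Cs R C → Dec (IsCover Rs Cs R C)
  isCover? Rs Cs R C = R ⊆? Rs ×-dec C ⊆? Cs ×-dec
    Finₚ.all? λ i → Finₚ.all? λ j →
      E i j Boolₚ.≟ true →-dec (i ∈? Rs →-dec (j ∈? Cs →-dec (i ∈? R ⊎-dec j ∈? C)))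

  minimumCover : ∀ Rs Cs → MinimumCover Rs Cs
  minimumCover Rs Cs with least-witness coverOfSize? (Rs , Sub.⊥ , trivialCover , refl)
    where
    CoverOfSize : ℕ → Set
    CoverOfSize k = ∃ λ R → ∃ λ C → IsCover Rs Cs R C × ∣ R ∣ + ∣ C ∣ ≡ k
    coverOfSize? : U.Decidable CoverOfSize
    coverOfSize? k = anySubset? λ R → anySubset? λ C → isCover? Rs Cs R C ×-dec Natₚ._≟_ (∣ R ∣ + ∣ C ∣) k
    trivialCover : IsCover Rs Cs Rs Sub.⊥
    trivialCover = (λ i∈ → i∈) , (λ j∈⊥ → contradiction j∈⊥ ∉⊥) , (λ _ _ _ i∈ _ → inj₁ i∈)
  ... | _ , (R , C , cov , refl) , least = record
    { rows = R ; cols = C ; isCover = cov ; minimum = λ R' C' cov' → least (R' , C' , cov' , refl) }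

  module _ {Rs : Subset a} {Cs : Subset b} where

    matching≤cover : ∀ {M R C} → IsMatching Rs Cs M → IsCover Rs Cs R C → count M ≤ ∣ R ∣ + ∣ C ∣
    matching≤cover {M} {R} {C} isM (_ , _ , covers) = count-≤-cover M oneRow oneColumn R C
      λ i j Mij → let Eij , i∈Rs , j∈Cs = edge i j Mij in covers i j Eij i∈Rs j∈Cs
      where open IsMatching isM

    pair-from-large-matching : ∀ {M R C} → IsMatching Rs Cs M → IsCover Rs Cs R C → ∣ R ∣ + ∣ C ∣ ≤ count M →
      KönigPair Rs Cs
    pair-from-large-matching {M} {R} {C} isM cov ≥cover = record
      { matching = M ; rows = R ; cols = C ; isMatching = isM ; isCover = cov
      ; count≡ = ≤-antisym (matching≤cover isM cov) ≥cover }

    IsMatching-∪ᵣ : ∀ {M N} → IsMatching Rs Cs M → IsMatching Rs Cs N →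
      (∀ i j j' → M i j ≡ true → N i j' ≡ true → ⊥) → (∀ i i' j → M i j ≡ true → N i' j ≡ true → ⊥) →
      IsMatching Rs Cs (M ∪ᵣ N)
    IsMatching-∪ᵣ {M} {N} isM isN rowsApart colsApart = record
      { edge      = λ i j MNij →
                      [ IsMatching.edge isM i j , IsMatching.edge isN i j ]′ (∨-true (M i j) (N i j) MNij)
      ; oneRow    = AtMostOnePerRow-∪ᵣ (IsMatching.oneRow isM) (IsMatching.oneRow isN) rowsApart
      ; oneColumn = AtMostOnePerColumn-∪ᵣ (IsMatching.oneColumn isM) (IsMatching.oneColumn isN) colsApart }

    IsMatching-single : ∀ {i j} → E i j ≡ true → i ∈ Rs → j ∈ Cs → IsMatching Rs Cs (single i j)
    IsMatching-single {i} {j} Eij i∈Rs j∈Cs = record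
      { edge      = λ x y s → let x≡i , y≡j = single-true i j x y s in
          subst₂ (λ x y → E x y ≡ true × x ∈ Rs × y ∈ Cs) (sym x≡i) (sym y≡j) (Eij , i∈Rs , j∈Cs)
      ; oneRow    = λ x y y' s s' →
          trans (proj₂ (single-true i j x y s)) (sym (proj₂ (single-true i j x y' s')))
      ; oneColumn = λ x x' y s s' →
          trans (proj₁ (single-true i j x y s)) (sym (proj₁ (single-true i j x' y s'))) }

  IsMatching-⊆ : ∀ {Rs Rs' Cs Cs' M} → Rs ⊆ Rs' → Cs ⊆ Cs' → IsMatching Rs Cs M → IsMatching Rs' Cs' M
  IsMatching-⊆ Rs⊆ Cs⊆ isM = record
    { edge = λ i j Mij → let Eij , i∈ , j∈ = IsMatching.edge isM i j Mij in Eij , Rs⊆ i∈ , Cs⊆ j∈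
    ; oneRow = IsMatching.oneRow isM ; oneColumn = IsMatching.oneColumn isM }

  cover-∪-cols : ∀ {Rs Cs R C R₁ C₁} → IsCover Rs Cs R C → IsCover R (Cs ─ C) R₁ C₁ → IsCover Rs Cs R₁ (C ∪ C₁)
  cover-∪-cols {Rs} {Cs} {R} {C} {R₁} {C₁} (R⊆Rs , C⊆Cs , covers) (R₁⊆R , C₁⊆ , covers₁) =
    R⊆Rs ∘ R₁⊆R , [ C⊆Cs , p─q⊆p Cs C ∘ C₁⊆ ]′ ∘ x∈p∪q⁻ C C₁ , covers'
    where
    covers' : ∀ i j → E i j ≡ true → i ∈ Rs → j ∈ Cs → i ∈ R₁ ⊎ j ∈ C ∪ C₁
    covers' i j Eij i∈Rs j∈Cs with covers i j Eij i∈Rs j∈Cs | j ∈? C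
    ... | inj₂ j∈C | _       = inj₂ (p⊆p∪q C₁ j∈C)
    ... | inj₁ _   | yes j∈C = inj₂ (p⊆p∪q C₁ j∈C)
    ... | inj₁ i∈R | no  j∉C =
      map₂ (q⊆p∪q C C₁) (covers₁ i j Eij i∈R (x∈p∧x∉q⇒x∈p─q j∈Cs j∉C))

  cover-∪-rows : ∀ {Rs Cs R C R₂ C₂} → IsCover Rs Cs R C → IsCover (Rs ─ R) C R₂ C₂ → IsCover Rs Cs (R ∪ R₂) C₂
  cover-∪-rows {Rs} {Cs} {R} {C} {R₂} {C₂} (R⊆Rs , C⊆Cs , covers) (R₂⊆ , C₂⊆C , covers₂) =
    [ R⊆Rs , p─q⊆p Rs R ∘ R₂⊆ ]′ ∘ x∈p∪q⁻ R R₂ , C⊆Cs ∘ C₂⊆C , covers'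
    where
    covers' : ∀ i j → E i j ≡ true → i ∈ Rs → j ∈ Cs → i ∈ R ∪ R₂ ⊎ j ∈ C₂
    covers' i j Eij i∈Rs j∈Cs with covers i j Eij i∈Rs j∈Cs | i ∈? R
    ... | inj₁ i∈R | _       = inj₁ (p⊆p∪q R₂ i∈R)
    ... | inj₂ _   | yes i∈R = inj₁ (p⊆p∪q R₂ i∈R)
    ... | inj₂ j∈C | no  i∉R =
      map₁ (q⊆p∪q R R₂) (covers₂ i j Eij (x∈p∧x∉q⇒x∈p─q i∈Rs i∉R) j∈C)

  cover-∪-removed : ∀ {Rs Cs X Y R C} → X ⊆ Rs → Y ⊆ Cs → IsCover (Rs ─ X) (Cs ─ Y) R C →
    IsCover Rs Cs (R ∪ X) (C ∪ Y)
  cover-∪-removed {Rs} {Cs} {X} {Y} {R} {C} X⊆Rs Y⊆Cs (R⊆ , C⊆ , covers) =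
    [ p─q⊆p Rs X ∘ R⊆ , X⊆Rs ]′ ∘ x∈p∪q⁻ R X , [ p─q⊆p Cs Y ∘ C⊆ , Y⊆Cs ]′ ∘ x∈p∪q⁻ C Y , covers'
    where
    covers' : ∀ i j → E i j ≡ true → i ∈ Rs → j ∈ Cs → i ∈ R ∪ X ⊎ j ∈ C ∪ Y
    covers' i j Eij i∈Rs j∈Cs with i ∈? X | j ∈? Y
    ... | yes i∈X | _       = inj₁ (q⊆p∪q R X i∈X)
    ... | no  _   | yes j∈Y = inj₂ (q⊆p∪q C Y j∈Y)
    ... | no  i∉X | no  j∉Y = map-⊎ (p⊆p∪q X) (p⊆p∪q Y)
      (covers i j Eij (x∈p∧x∉q⇒x∈p─q i∈Rs i∉X) (x∈p∧x∉q⇒x∈p─q j∈Cs j∉Y))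

  module _ {Rs : Subset a} {Cs : Subset b} (min : MinimumCover Rs Cs) where
    open MinimumCover min renaming (rows to R; cols to C)

    minimum-rows≤ : (P : KönigPair R (Cs ─ C)) → ∣ R ∣ ≤ count (KönigPair.matching P)
    minimum-rows≤ P = +-cancelʳ-≤ (∣ C ∣) (∣ R ∣) (count M₁) (begin
      ∣ R ∣ + ∣ C ∣          ≤⟨ minimum R₁ (C ∪ C₁) (cover-∪-cols isCover P.isCover) ⟩
      ∣ R₁ ∣ + ∣ (C ∪ C₁) ∣    ≤⟨ +-monoʳ-≤ ∣ R₁ ∣ (∣p∪q∣≤∣p∣+∣q∣ C C₁) ⟩
      ∣ R₁ ∣ + (∣ C ∣ + ∣ C₁ ∣) ≡⟨ x∙yz≈xz∙y (∣ R₁ ∣) (∣ C ∣) (∣ C₁ ∣) ⟩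
      ∣ R₁ ∣ + ∣ C₁ ∣ + ∣ C ∣ ≡⟨ cong (_+ ∣ C ∣) P.count≡ ⟨
      count M₁ + ∣ C ∣ ∎)
      where
      open ≤-Reasoning
      module P = KönigPair P
      open P using () renaming (matching to M₁; rows to R₁; cols to C₁)

    minimum-cols≤ : (P : KönigPair (Rs ─ R) C) → ∣ C ∣ ≤ count (KönigPair.matching P)
    minimum-cols≤ P = +-cancelˡ-≤ (∣ R ∣) (∣ C ∣) (count M₂) (begin
      ∣ R ∣ + ∣ C ∣          ≤⟨ minimum (R ∪ R₂) C₂ (cover-∪-rows isCover P.isCover) ⟩
      ∣ (R ∪ R₂) ∣ + ∣ C₂ ∣    ≤⟨ +-monoˡ-≤ ∣ C₂ ∣ (∣p∪q∣≤∣p∣+∣q∣ R R₂) ⟩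
      ∣ R ∣ + ∣ R₂ ∣ + ∣ C₂ ∣ ≡⟨ +-assoc (∣ R ∣) (∣ R₂ ∣) (∣ C₂ ∣) ⟩
      ∣ R ∣ + (∣ R₂ ∣ + ∣ C₂ ∣) ≡⟨ cong (∣ R ∣ +_) P.count≡ ⟨
      ∣ R ∣ + count M₂ ∎)
      where
      open ≤-Reasoning
      module P = KönigPair P
      open P using () renaming (matching to M₂; rows to R₂; cols to C₂)

  Smaller : Subset a → Subset b → Set
  Smaller Rs Cs = ∀ Rs' Cs' → ∣ Rs' ∣ + ∣ Cs' ∣ < ∣ Rs ∣ + ∣ Cs ∣ → KönigPair Rs' Cs'

  module _ {Rs : Subset a} {Cs : Subset b} (smaller : Smaller Rs Cs) where

    pair-from-split-cover : (min : MinimumCover Rs Cs) → ∀ {i j} →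
      i ∈ MinimumCover.rows min → j ∈ MinimumCover.cols min → KönigPair Rs Cs
    pair-from-split-cover min {i} {j} i∈R j∈C = pair-from-large-matching isMatching isCover (begin
      ∣ R ∣ + ∣ C ∣                ≤⟨ +-mono-≤ (minimum-rows≤ min P₁) (minimum-cols≤ min P₂) ⟩
      count P₁.matching + count P₂.matching ≡⟨ count-∪ᵣ P₁.matching P₂.matching (λ x y → rowsApart x y y) ⟨
      count (P₁.matching ∪ᵣ P₂.matching) ∎)
      where
      open ≤-Reasoning
      open MinimumCover min renaming (rows to R; cols to C)
      R⊆Rs : R ⊆ Rs
      R⊆Rs = proj₁ isCover
      C⊆Cs : C ⊆ Cs
      C⊆Cs = proj₁ (proj₂ isCover)
      P₁ : KönigPair R (Cs ─ C)
      P₁ = smaller R (Cs ─ C)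
        (+-mono-≤-< (p⊆q⇒∣p∣≤∣q∣ R⊆Rs) (p∩q≢∅⇒∣p─q∣<∣p∣ Cs C (j , x∈p∩q⁺ (C⊆Cs j∈C , j∈C))))
      P₂ : KönigPair (Rs ─ R) C
      P₂ = smaller (Rs ─ R) C
        (+-mono-<-≤ (p∩q≢∅⇒∣p─q∣<∣p∣ Rs R (i , x∈p∩q⁺ (R⊆Rs i∈R , i∈R))) (p⊆q⇒∣p∣≤∣q∣ C⊆Cs))
      module P₁ = KönigPair P₁
      module P₂ = KönigPair P₂
      rowsApart : ∀ x y y' → P₁.matching x y ≡ true → P₂.matching x y' ≡ true → ⊥
      rowsApart _ _ _ M₁xy M₂xy' =
        x∈p─q⇒x∉q Rs R (IsMatching.row∈ P₂.isMatching M₂xy') (IsMatching.row∈ P₁.isMatching M₁xy)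
      colsApart : ∀ x x' y → P₁.matching x y ≡ true → P₂.matching x' y ≡ true → ⊥
      colsApart _ _ _ M₁xy M₂x'y =
        x∈p─q⇒x∉q Cs C (IsMatching.column∈ P₁.isMatching M₁xy) (IsMatching.column∈ P₂.isMatching M₂x'y)
      isMatching : IsMatching Rs Cs (P₁.matching ∪ᵣ P₂.matching)
      isMatching = IsMatching-∪ᵣ (IsMatching-⊆ R⊆Rs (p─q⊆p Cs C) P₁.isMatching)
                                 (IsMatching-⊆ (p─q⊆p Rs R) C⊆Cs P₂.isMatching) rowsApart colsApart

    module _ (min : MinimumCover Rs Cs) {i j} (Eij : E i j ≡ true) (i∈Rs : i ∈ Rs) (j∈Cs : j ∈ Cs) where
      open MinimumCover min renaming (rows to R; cols to C)

      private
        P : KönigPair (Rs - i) (Cs - j)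
        P = smaller (Rs - i) (Cs - j) (+-mono-<-≤ (x∈p⇒∣p-x∣<∣p∣ i∈Rs) (∣p─q∣≤∣p∣ Cs ⁅ j ⁆))
        module P = KönigPair P

      pair-from-extended-matching : ∣ R ∣ + ∣ C ∣ ≤ suc (count P.matching) → KönigPair Rs Cs
      pair-from-extended-matching τ≤1+ν = pair-from-large-matching isMatching isCover (begin
        ∣ R ∣ + ∣ C ∣                  ≤⟨ τ≤1+ν ⟩
        suc (count P.matching)         ≡⟨ +-comm 1 _ ⟩
        count P.matching + 1
          ≤⟨ +-monoʳ-≤ (count P.matching) (entry⇒1≤count (single i j) i j (single-self i j)) ⟩
        count P.matching + count (single i j) ≡⟨ count-∪ᵣ P.matching (single i j) (λ x y → rowsApart x y y) ⟨
        count (P.matching ∪ᵣ single i j) ∎)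
        where
        open ≤-Reasoning
        removed : ∀ {n} {x y : Fin n} (p : Subset n) → x ∈ p - y → x ≡ y → ⊥
        removed {y = y} p x∈p-y refl = x∈p─q⇒x∉q p ⁅ y ⁆ x∈p-y (x∈⁅x⁆ y)
        rowsApart : ∀ x y y' → P.matching x y ≡ true → single i j x y' ≡ true → ⊥
        rowsApart x _ y' Mxy s = removed Rs (IsMatching.row∈ P.isMatching Mxy) (proj₁ (single-true i j x y' s))
        colsApart : ∀ x x' y → P.matching x y ≡ true → single i j x' y ≡ true → ⊥
        colsApart _ x' y Mxy s =
          removed Cs (IsMatching.column∈ P.isMatching Mxy) (proj₂ (single-true i j x' y s))
        isMatching : IsMatching Rs Cs (P.matching ∪ᵣ single i j)
        isMatching = IsMatching-∪ᵣ (IsMatching-⊆ (p─q⊆p Rs ⁅ i ⁆) (p─q⊆p Cs ⁅ j ⁆) P.isMatching)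
                                   (IsMatching-single Eij i∈Rs j∈Cs) rowsApart colsApart

      pair-from-extended-cover : 2 + count P.matching ≤ ∣ R ∣ + ∣ C ∣ → KönigPair Rs Cs
      pair-from-extended-cover 2+ν≤τ =
        pair-from-split-cover min' (q⊆p∪q P.rows ⁅ i ⁆ (x∈⁅x⁆ i)) (q⊆p∪q P.cols ⁅ j ⁆ (x∈⁅x⁆ j))
        where
        ⁅⁆⊆ : ∀ {n} {x : Fin n} {p : Subset n} → x ∈ p → ⁅ x ⁆ ⊆ p
        ⁅⁆⊆ {p = p} x∈p y∈⁅x⁆ = subst (_∈ p) (sym (x∈⁅y⁆⇒x≡y _ y∈⁅x⁆)) x∈p
        size≤ : ∣ (P.rows ∪ ⁅ i ⁆) ∣ + ∣ (P.cols ∪ ⁅ j ⁆) ∣ ≤ ∣ R ∣ + ∣ C ∣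
        size≤ = begin
          ∣ (P.rows ∪ ⁅ i ⁆) ∣ + ∣ (P.cols ∪ ⁅ j ⁆) ∣
            ≤⟨ +-mono-≤ (∣p∪q∣≤∣p∣+∣q∣ P.rows ⁅ i ⁆) (∣p∪q∣≤∣p∣+∣q∣ P.cols ⁅ j ⁆) ⟩
          (∣ P.rows ∣ + ∣ ⁅ i ⁆ ∣) + (∣ P.cols ∣ + ∣ ⁅ j ⁆ ∣)
            ≡⟨ interchange (∣ P.rows ∣) (∣ ⁅ i ⁆ ∣) (∣ P.cols ∣) (∣ ⁅ j ⁆ ∣) ⟩
          (∣ P.rows ∣ + ∣ P.cols ∣) + (∣ ⁅ i ⁆ ∣ + ∣ ⁅ j ⁆ ∣)
            ≡⟨ cong₂ _+_ (sym P.count≡) (cong₂ _+_ (∣⁅x⁆∣≡1 i) (∣⁅x⁆∣≡1 j)) ⟩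
          count P.matching + 2    ≡⟨ +-comm (count P.matching) 2 ⟩
          2 + count P.matching    ≤⟨ 2+ν≤τ ⟩
          ∣ R ∣ + ∣ C ∣ ∎
          where open ≤-Reasoning
        min' : MinimumCover Rs Cs
        min' = record
          { rows    = P.rows ∪ ⁅ i ⁆
          ; cols    = P.cols ∪ ⁅ j ⁆
          ; isCover = cover-∪-removed (⁅⁆⊆ i∈Rs) (⁅⁆⊆ j∈Cs) P.isCover
          ; minimum = λ R' C' cov → ≤-trans size≤ (minimum R' C' cov) }

      pair-from-edge : KönigPair Rs Cs
      pair-from-edge with ∣ R ∣ + ∣ C ∣ ≤? suc (count P.matching)
      ... | yes τ≤1+ν = pair-from-extended-matching τ≤1+ν
      ... | no  τ≰1+ν = pair-from-extended-cover (≰⇒> τ≰1+ν)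

  emptyPair : ∀ {Rs Cs} → (∀ i j → E i j ≡ true → i ∈ Rs → j ∈ Cs → ⊥) → KönigPair Rs Cs
  emptyPair noEdge = record
    { matching   = λ _ _ → false
    ; rows       = Sub.⊥
    ; cols       = Sub.⊥
    ; isMatching = record { edge = λ _ _ () ; oneRow = λ _ _ _ () ; oneColumn = λ _ _ _ () }
    ; isCover    = (λ x∈⊥ → contradiction x∈⊥ ∉⊥) , (λ x∈⊥ → contradiction x∈⊥ ∉⊥) ,
                   (λ i j Eij i∈Rs j∈Cs → ⊥-elim (noEdge i j Eij i∈Rs j∈Cs))
    ; count≡     = trans (count-empty a b) (sym (cong₂ _+_ (∣⊥∣≡0 a) (∣⊥∣≡0 b))) }

  königPair : ∀ Rs Cs → KönigPair Rs Cs
  königPair Rs Cs = <-rec (λ n → ∀ Rs Cs → ∣ Rs ∣ + ∣ Cs ∣ ≡ n → KönigPair Rs Cs) step _ Rs Cs refl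
    where
    step : ∀ n → (∀ {n'} → n' < n → ∀ Rs Cs → ∣ Rs ∣ + ∣ Cs ∣ ≡ n' → KönigPair Rs Cs) →
      ∀ Rs Cs → ∣ Rs ∣ + ∣ Cs ∣ ≡ n → KönigPair Rs Cs
    step _ below Rs Cs refl
      with Finₚ.any? (λ i → Finₚ.any? λ j → E i j Boolₚ.≟ true ×-dec i ∈? Rs ×-dec j ∈? Cs)
    ... | yes (i , j , Eij , i∈Rs , j∈Cs) =
      pair-from-edge (λ Rs' Cs' lt → below lt Rs' Cs' refl) (minimumCover Rs Cs) Eij i∈Rs j∈Cs
    ... | no noEdge = emptyPair λ i j Eij i∈Rs j∈Cs → noEdge (i , j , Eij , i∈Rs , j∈Cs)

module Halves (m : ℕ) where

  top : Fin m → Fin (m + m)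
  top p = p ↑ˡ m

  bot : Fin m → Fin (m + m)
  bot p = rot (top p)

  rot-bot : ∀ p → rot (bot p) ≡ top p
  rot-bot p = Finₚ.opposite-involutive (top p)

  bot≡↑ʳ : ∀ p → bot p ≡ m ↑ʳ opposite p
  bot≡↑ʳ p = Finₚ.toℕ-injective (begin
    toℕ (opposite (p ↑ˡ m))      ≡⟨ Finₚ.opposite-prop (p ↑ˡ m) ⟩
    m + m ∸ suc (toℕ (p ↑ˡ m))   ≡⟨ cong (λ k → m + m ∸ suc k) (Finₚ.toℕ-↑ˡ p m) ⟩
    m + m ∸ suc (toℕ p)          ≡⟨ +-∸-assoc m (Finₚ.toℕ<n p) ⟩
    m + (m ∸ suc (toℕ p))        ≡⟨ cong (m +_) (Finₚ.opposite-prop p) ⟨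
    m + toℕ (opposite p)         ≡⟨ Finₚ.toℕ-↑ʳ m (opposite p) ⟨
    toℕ (m ↑ʳ opposite p)        ∎)
    where open ≡-Reasoning

  half : Fin (m + m) → Fin m
  half x = [ id , opposite ]′ (splitAt m x)

  isBot : Fin (m + m) → Bool
  isBot x = [ const false , const true ]′ (splitAt m x)

  half-top : ∀ p → half (top p) ≡ p
  half-top p rewrite Finₚ.splitAt-↑ˡ m p m = refl

  isBot-top : ∀ p → isBot (top p) ≡ false
  isBot-top p rewrite Finₚ.splitAt-↑ˡ m p m = refl

  half-bot : ∀ p → half (bot p) ≡ p
  half-bot p rewrite bot≡↑ʳ p | Finₚ.splitAt-↑ʳ m m (opposite p) = Finₚ.opposite-involutive p

  isBot-bot : ∀ p → isBot (bot p) ≡ true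
  isBot-bot p rewrite bot≡↑ʳ p | Finₚ.splitAt-↑ʳ m m (opposite p) = refl

  data View : Fin (m + m) → Set where
    top-view : ∀ p → View (top p)
    bot-view : ∀ p → View (bot p)

  view : ∀ x → View x
  view x = subst View (Finₚ.join-splitAt m m x) (view-join (splitAt m x))
    where
    view-join : ∀ s → View (join m m s)
    view-join (inj₁ p) = top-view p
    view-join (inj₂ q) = subst View (trans (bot≡↑ʳ (opposite q)) (cong (m ↑ʳ_) (Finₚ.opposite-involutive q)))
                                    (bot-view (opposite q))

  half-rot : ∀ x → half (rot x) ≡ half x
  half-rot x with view x
  ... | top-view p = trans (half-bot p) (sym (half-top p))
  ... | bot-view p rewrite rot-bot p = trans (half-top p) (sym (half-bot p))

  isBot-rot : ∀ x → isBot (rot x) ≡ not (isBot x)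
  isBot-rot x with view x
  ... | top-view p rewrite isBot-top p = isBot-bot p
  ... | bot-view p rewrite rot-bot p | isBot-bot p = isBot-top p

  half-isBot-injective : ∀ x y → half x ≡ half y → isBot x ≡ isBot y → x ≡ y
  half-isBot-injective x y hx≡hy sx≡sy with view x | view y
  ... | top-view p | top-view q = cong top (trans (sym (half-top p)) (trans hx≡hy (half-top q)))
  ... | bot-view p | bot-view q = cong bot (trans (sym (half-bot p)) (trans hx≡hy (half-bot q)))
  ... | top-view p | bot-view q = contradiction (trans (sym (isBot-top p)) (trans sx≡sy (isBot-bot q))) λ ()
  ... | bot-view p | top-view q = contradiction (trans (sym (isBot-bot p)) (trans sx≡sy (isBot-top q))) λ ()

  sumFin-halves : (f : Fin (m + m) → ℕ) → sumFin f ≡ sumFin (λ p → f (top p) + f (bot p))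
  sumFin-halves f = begin
    sumFin f                                                 ≡⟨ sumFin-↑ m f ⟩
    sumFin (f ∘ top) + sumFin (λ q → f (m ↑ʳ q))             ≡⟨ cong (sumFin (f ∘ top) +_) bots ⟨
    sumFin (f ∘ top) + sumFin (f ∘ bot)                      ≡⟨ sumFin-+ (f ∘ top) (f ∘ bot) ⟨
    sumFin (λ p → f (top p) + f (bot p))                     ∎
    where
    open ≡-Reasoning
    bots : sumFin (f ∘ bot) ≡ sumFin (λ q → f (m ↑ʳ q))
    bots = trans (sumFin-cong (cong f ∘ bot≡↑ʳ)) (sumFin-opposite m (λ q → f (m ↑ʳ q)))

  sumFin-∘half : (g : Fin m → ℕ) → sumFin (g ∘ half) ≡ sumFin g + sumFin g
  sumFin-∘half g = begin
    sumFin (g ∘ half)                          ≡⟨ sumFin-halves (g ∘ half) ⟩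
    sumFin (λ p → g (half (top p)) + g (half (bot p)))
      ≡⟨ sumFin-cong (λ p → cong₂ _+_ (cong g (half-top p)) (cong g (half-bot p))) ⟩
    sumFin (λ p → g p + g p)                   ≡⟨ sumFin-+ g g ⟩
    sumFin g + sumFin g                        ∎
    where open ≡-Reasoning

xor-cancelˡ : ∀ a {b c} → a xor b ≡ a xor c → b ≡ c
xor-cancelˡ false eq = eq
xor-cancelˡ true  eq = Boolₚ.not-injective eq

xor-cancelʳ : ∀ {a b} c → a xor c ≡ b xor c → a ≡ b
xor-cancelʳ {a} {b} c eq = xor-cancelˡ c (trans (Boolₚ.xor-comm c a) (trans eq (Boolₚ.xor-comm b c)))

not-xor-not : ∀ a b → not a xor not b ≡ a xor b
not-xor-not true  b     = refl
not-xor-not false true  = refl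
not-xor-not false false = refl

if-true⇒∨ : ∀ k t c → (if k then c else t) ≡ true → t ∨ c ≡ true
if-true⇒∨ true  t c c≡true = trans (cong (t ∨_) c≡true) (Boolₚ.∨-zeroʳ t)
if-true⇒∨ false t c t≡true = cong (_∨ c) t≡true

∨⇒if-true : ∀ k t c → t ∨ c ≡ true → t xor k ≡ true → (if k then c else t) ≡ true
∨⇒if-true false true  c _   _ = refl
∨⇒if-true true  false c t∨c _ = t∨c

module Folding (m : ℕ) (A : Matrix01 (m + m)) (centro : Centrosymmetric A) where
  open Halves m

  -- In m × m blocks A = [[B, C], [Cπ, Bπ]], and E is B ∨ C with the columns of C reversed.
  E : BoolRel m m
  E p q = A (top p) (top q) ∨ A (top p) (bot q)

  A-by-halves : ∀ x y → A x y ≡ (if isBot x xor isBot y then A (top (half x)) (bot (half y))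
                                                        else A (top (half x)) (top (half y)))
  A-by-halves x y with view x | view y
  ... | top-view p | top-view q rewrite half-top p | half-top q | isBot-top p | isBot-top q = refl
  ... | top-view p | bot-view q rewrite half-top p | half-bot q | isBot-top p | isBot-bot q = refl
  ... | bot-view p | bot-view q rewrite half-bot p | half-bot q | isBot-bot p | isBot-bot q =
    centro (top p) (top q)
  ... | bot-view p | top-view q rewrite half-bot p | half-top q | isBot-bot p | isBot-top q =
    trans (cong (A (bot p)) (sym (rot-bot q))) (centro (top p) (bot q))

  lift : Subset m → Subset (m + m)
  lift P = tabulate (lookup P ∘ half)

  ∈-lift : ∀ {P x} → half x ∈ P → x ∈ lift P
  ∈-lift {P} {x} hx∈P = lookup⇒[]= x (lift P) (trans (lookup∘tabulate (lookup P ∘ half) x) ([]=⇒lookup hx∈P))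

  lift-∈ : ∀ {P x} → x ∈ lift P → half x ∈ P
  lift-∈ {P} {x} x∈ = lookup⇒[]= (half x) P (trans (sym (lookup∘tabulate (lookup P ∘ half) x)) ([]=⇒lookup x∈))

  ∣lift∣ : ∀ P → ∣ lift P ∣ ≡ ∣ P ∣ + ∣ P ∣
  ∣lift∣ P = begin
    ∣ lift P ∣                               ≡⟨ ∣p∣≡sumFin (lift P) ⟩
    sumFin (indicator ∘ lookup (lift P))
      ≡⟨ sumFin-cong (cong indicator ∘ lookup∘tabulate (lookup P ∘ half)) ⟩
    sumFin (indicator ∘ lookup P ∘ half)     ≡⟨ sumFin-∘half (indicator ∘ lookup P) ⟩
    sumFin (indicator ∘ lookup P) + sumFin (indicator ∘ lookup P)
      ≡⟨ cong₂ _+_ (∣p∣≡sumFin P) (∣p∣≡sumFin P) ⟨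
    ∣ P ∣ + ∣ P ∣                            ∎
    where open ≡-Reasoning

  lift-cover : ∀ {R C} → König.IsCover E Sub.⊤ Sub.⊤ R C → IsCentroCover A (lift R) (lift C)
  lift-cover {R} {C} (_ , _ , covers) =
    (λ x x∈ → ∈-lift (subst (_∈ R) (sym (half-rot x)) (lift-∈ x∈))) ,
    (λ y y∈ → ∈-lift (subst (_∈ C) (sym (half-rot y)) (lift-∈ y∈))) ,
    λ x y Axy → map-⊎ ∈-lift ∈-lift (covers (half x) (half y) (E-half x y Axy) ∈⊤ ∈⊤)
    where
    E-half : ∀ x y → A x y ≡ true → E (half x) (half y) ≡ true
    E-half x y Axy = if-true⇒∨ (isBot x xor isBot y) _ _ (trans (sym (A-by-halves x y)) Axy)

  -- A matched pair (p, q) of E is spread over the π-orbit of (top p, top q) when that entry of A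
  -- is 1, and over the π-orbit of (top p, bot q) otherwise.
  chooses : Fin (m + m) → Fin (m + m) → Bool
  chooses x y = A (top (half x)) (top (half y)) xor isBot x xor isBot y

  chooses-row : ∀ x y y' → half y ≡ half y' → chooses x y ≡ true → chooses x y' ≡ true → y ≡ y'
  chooses-row x y y' hy≡hy' cy cy' = half-isBot-injective y y' hy≡hy'
    (xor-cancelˡ (isBot x) (xor-cancelˡ (A (top (half x)) (top (half y)))
      (trans cy (sym (trans (cong (λ q → A (top (half x)) (top q) xor isBot x xor isBot y') hy≡hy') cy')))))

  chooses-column : ∀ x x' y → half x ≡ half x' → chooses x y ≡ true → chooses x' y ≡ true → x ≡ x'
  chooses-column x x' y hx≡hx' cx cx' = half-isBot-injective x x' hx≡hx'
    (xor-cancelʳ (isBot y) (xor-cancelˡ (A (top (half x)) (top (half y)))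
      (trans cx (sym (trans (cong (λ p → A (top p) (top (half y)) xor isBot x' xor isBot y) hx≡hx') cx')))))

  spread : BoolRel m m → PosSet (m + m)
  spread M x y = M (half x) (half y) ∧ chooses x y

  spread-rot : ∀ M x y → spread M (rot x) (rot y) ≡ spread M x y
  spread-rot M x y
    rewrite half-rot x | half-rot y | isBot-rot x | isBot-rot y | not-xor-not (isBot x) (isBot y) = refl

  count-spread : ∀ M → count (spread M) ≡ count M + count M
  count-spread M = begin
    count (spread M)                         ≡⟨ sumFin-cong row ⟩
    sumFin (rowM ∘ half)                     ≡⟨ sumFin-∘half rowM ⟩
    count M + count M                        ∎
    where
    open ≡-Reasoning
    rowM : Fin m → ℕ
    rowM p = sumFin (λ q → indicator (M p q))
    one-of-two : ∀ b t s →
      indicator (b ∧ (t xor s xor false)) + indicator (b ∧ (t xor s xor true)) ≡ indicator b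
    one-of-two false t     s     = refl
    one-of-two true  true  true  = refl
    one-of-two true  true  false = refl
    one-of-two true  false true  = refl
    one-of-two true  false false = refl
    row : ∀ x → sumFin (λ y → indicator (spread M x y)) ≡ rowM (half x)
    row x = trans (sumFin-halves (λ y → indicator (spread M x y))) (sumFin-cong pair)
      where
      pair : ∀ q → indicator (spread M x (top q)) + indicator (spread M x (bot q)) ≡ indicator (M (half x) q)
      pair q rewrite half-top q | half-bot q | isBot-top q | isBot-bot q =
        one-of-two (M (half x) q) (A (top (half x)) (top q)) (isBot x)

  module _ {M : BoolRel m m} (isM : König.IsMatching E Sub.⊤ Sub.⊤ M) where
    open König.IsMatching isM

    spread⊆A : ∀ x y → spread M x y ≡ true → A x y ≡ true
    spread⊆A x y Sxy = trans (A-by-halves x y)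
      (∨⇒if-true (isBot x xor isBot y) _ _ (proj₁ (edge (half x) (half y) Mxy)) (Boolₚ.∧-conicalʳ _ _ Sxy))
      where
      Mxy : M (half x) (half y) ≡ true
      Mxy = Boolₚ.∧-conicalˡ _ _ Sxy

    spread-oneRow : AtMostOnePerRow (spread M)
    spread-oneRow x y y' Sxy Sxy' = chooses-row x y y'
      (oneRow (half x) (half y) (half y') (Boolₚ.∧-conicalˡ _ _ Sxy) (Boolₚ.∧-conicalˡ _ _ Sxy'))
      (Boolₚ.∧-conicalʳ _ _ Sxy) (Boolₚ.∧-conicalʳ _ _ Sxy')

    spread-oneColumn : AtMostOnePerColumn (spread M)
    spread-oneColumn x x' y Sxy Sx'y = chooses-column x x' y
      (oneColumn (half x) (half x') (half y) (Boolₚ.∧-conicalˡ _ _ Sxy) (Boolₚ.∧-conicalˡ _ _ Sx'y))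
      (Boolₚ.∧-conicalʳ _ _ Sxy) (Boolₚ.∧-conicalʳ _ _ Sx'y)

  centrosymmetric-König : ∃ λ S → ∃ λ R → ∃ λ C →
    IsPiIndepSet A S × IsCentroCover A R C × coverSize R C ≡ card S
  centrosymmetric-König =
    spread P.matching , lift P.rows , lift P.cols ,
    (spread⊆A P.isMatching , (λ x y Sxy → trans (spread-rot P.matching x y) Sxy) ,
     spread-oneRow P.isMatching , spread-oneColumn P.isMatching) ,
    lift-cover P.isCover , sizes
    where
    module P = König.KönigPair (König.königPair E Sub.⊤ Sub.⊤)
    sizes : coverSize (lift P.rows) (lift P.cols) ≡ card (spread P.matching)
    sizes = begin
      ∣ lift P.rows ∣ + ∣ lift P.cols ∣                 ≡⟨ cong₂ _+_ (∣lift∣ P.rows) (∣lift∣ P.cols) ⟩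
      (∣ P.rows ∣ + ∣ P.rows ∣) + (∣ P.cols ∣ + ∣ P.cols ∣) ≡⟨ interchange (∣ P.rows ∣) _ _ _ ⟩
      (∣ P.rows ∣ + ∣ P.cols ∣) + (∣ P.rows ∣ + ∣ P.cols ∣) ≡⟨ cong₂ _+_ P.count≡ P.count≡ ⟨
      count P.matching + count P.matching              ≡⟨ count-spread P.matching ⟨
      card (spread P.matching)                          ∎
      where open ≡-Reasoning

indep≤cover : ∀ {n} {A : Matrix01 n} {S R C} → IsPiIndepSet A S → IsCentroCover A R C →
  card S ≤ coverSize R C
indep≤cover {S = S} {R} {C} (S⊆A , _ , oneRow , oneColumn) (_ , _ , covers) =
  count-≤-cover S oneRow oneColumn R C (λ i j Sij → covers i j (S⊆A i j Sij))

π-closed⇒centrosymmetric : ∀ {n} {S : Matrix01 n} → (∀ i j → S i j ≡ true → S (rot i) (rot j) ≡ true) →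
  Centrosymmetric S
π-closed⇒centrosymmetric {S = S} closed i j with S i j in Sij | S (rot i) (rot j) in Sπij
... | true  | true  = refl
... | false | false = refl
... | true  | false = trans (sym Sπij) (closed i j Sij)
... | false | true  = trans (sym Sij-true) Sij
  where
  Sij-true : S i j ≡ true
  Sij-true = subst₂ (λ x y → S x y ≡ true) (Finₚ.opposite-involutive i) (Finₚ.opposite-involutive j)
                    (closed (rot i) (rot j) Sπij)

module _ {n : ℕ} {A : Matrix01 n} where

  permutation≤cover : ∀ {P R C} → IsPermutationMatrix P → Centrosymmetric P → P ≤ₘ A →
    IsCentroCover A R C → n ≤ coverSize R C
  permutation≤cover {P} (rows , columns) P-centro P≤A cover =
    ≤-trans (rows-occupied⇒≤count P λ i → proj₁ (rows i) , proj₁ (proj₂ (rows i))) (indep≤cover P-indep cover)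
    where
    P-indep : IsPiIndepSet A P
    P-indep = P≤A , (λ i j Pij → trans (P-centro i j) Pij) ,
      (λ i j j' Pij Pij' → trans (proj₂ (proj₂ (rows i)) j Pij) (sym (proj₂ (proj₂ (rows i)) j' Pij'))) ,
      (λ i i' j Pij Pi'j → trans (proj₂ (proj₂ (columns j)) i Pij) (sym (proj₂ (proj₂ (columns j)) i' Pi'j)))

  full-indep⇒permutation : ∀ {S} → IsPiIndepSet A S → n ≤ card S →
    IsPermutationMatrix S × Centrosymmetric S × S ≤ₘ A
  full-indep⇒permutation {S} (S⊆A , π-closed , oneRow , oneColumn) n≤card =
    (row , column) , π-closed⇒centrosymmetric π-closed , S⊆A
    where
    row : ∀ i → Σ (Fin n) λ j → (S i j ≡ true) × (∀ j' → S i j' ≡ true → j' ≡ j)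
    row i = let j , Sij = ≤count⇒rows-occupied S oneRow n≤card i in
      j , Sij , λ j' Sij' → oneRow i j' j Sij' Sij
    column : ∀ j → Σ (Fin n) λ i → (S i j ≡ true) × (∀ i' → S i' j ≡ true → i' ≡ i)
    column j = let i , Sij = ≤count⇒rows-occupied (flip S) (λ j i i' → oneColumn i i' j)
                                                  (≤-trans n≤card (≤-reflexive (sym (count-flip S)))) j in
      i , Sij , λ i' Si'j → oneColumn i' i j Si'j Sij

theorem2p1 : (m : ℕ) → 1 ≤ m → (A : Matrix01 (m + m)) → Centrosymmetric A →
    ((Σ (Matrix01 (m + m)) λ P → IsPermutationMatrix P × Centrosymmetric P × (P ≤ₘ A))
      ⇔ (¬ (Σ (Subset (m + m)) λ R → Σ (Subset (m + m)) λ C →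
              IsCentroCover A R C × (coverSize R C < m + m))))
    × (∃ λ k → IsRhoPi A k × IsBetaPi A k)
theorem2p1 m _ A centro with Folding.centrosymmetric-König m A centro
... | S , R , C , S-indep , S-cover , size≡ =
  mk⇔ (λ (P , perm , P-centro , P≤A) (_ , _ , cover , small) →
         <⇒≱ small (permutation≤cover perm P-centro P≤A cover))
      (λ noSmallCover → S , full-indep⇒permutation S-indep (≮⇒≥ λ small →
         noSmallCover (R , C , S-cover , subst (_< m + m) (sym size≡) small))) ,
  card S , ((S , S-indep , refl) , λ _ indep → ≤-trans (indep≤cover indep S-cover) (≤-reflexive size≡)) ,
           ((R , C , S-cover , size≡) , λ _ _ cover → indep≤cover S-indep cover)
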